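{- Let $J,I,I'$ be incidence graphs with $\hom(J,I)\neq\hom(J,I')$, let $e\in B(J)$ and let $s\subseteq N_J(e)$. Then for every $m\in\mathbb{N}$ there exists $n\in\mathbb{N}$ with $n\ge m$ such that $J_n:=J+n\cdot s$ satisfies $\hom(J_n,I)\neq\hom(J_n,I')$.
   Context: An incidence graph $I=(R(I),B(I),E(I))$ consists of disjoint finite sets $R(I)$ of red nodes and $B(I)$ of blue nodes and $E(I)\subseteq B(I)\times R(I)$ such that every red node is adjacent to some blue node; $N_I(x)$ is the neighbourhood of $x$. A homomorphism from $J$ to $I$ is a pair of maps $h_R:R(J)\to R(I)$, $h_B:B(J)\to B(I)$ with $(h_B(e),h_R(v))\in E(I)$ for all $(e,v)\in E(J)$; $\hom(J,I)$ is their number. For an incidence graph $J$, $s\subseteq R(J)$ and $n\in\mathbb{N}$, $J+n\cdot s$ is obtained from $J$ by adding $n$ new blue nodes $\hat e_1,\dots,\hat e_n$ and edges $(\hat e_i,v)$ for all $i\in[n]$ and $v\in s$, so that $N(\hat e_i)=s$. -}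

module Defs where

open import Data.Nat using (ℕ; zero; suc; _+_)
open import Data.Fin using (Fin; zero; suc; splitAt)
open import Data.Bool using (Bool; true; false; _∧_; _∨_; not; if_then_else_)
open import Data.List using (List; []; _∷_; map; concatMap; allFin; length; filter; cartesianProduct)
open import Data.Bool.ListAction using (and)
import Data.Fin.Properties
open import Data.Sum using (inj₁; inj₂)
open import Data.Product using (Σ; ∃; _×_; _,_; proj₁; proj₂)
open import Relation.Binary.PropositionalEquality using (_≡_)
open import Relation.Nullary.Decidable using (does)
open import Data.Bool.Properties using (_≟_)

record IncGraph : Set where
  field
    red  : ℕ
    blue : ℕ
    E    : Fin blue → Fin red → Bool
    covered : (v : Fin red) → ∃ λ (e : Fin blue) → E e v ≡ true
open IncGraph public

-- All functions Fin k → Fin m (as a list, each function exactly once).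
allFuns : (k m : ℕ) → List (Fin k → Fin m)
allFuns zero    m = (λ ()) ∷ []
allFuns (suc k) m =
  concatMap (λ i → map (λ f → λ { zero → i ; (suc x) → f x }) (allFuns k m)) (allFin m)

allB : {A : Set} → (A → Bool) → List A → Bool
allB p xs = and (map p xs)

isHom : (J I : IncGraph) → (Fin (red J) → Fin (red I)) → (Fin (blue J) → Fin (blue I)) → Bool
isHom J I hR hB =
  allB (λ e → allB (λ v → not (E J e v) ∨ E I (hB e) (hR v)) (allFin (red J))) (allFin (blue J))

hom : IncGraph → IncGraph → ℕ
hom J I = length (filter (λ p → isHom J I (proj₁ p) (proj₂ p) ≟ true)
                   (cartesianProduct (allFuns (red J) (red I)) (allFuns (blue J) (blue I))))

addCopies : (J : IncGraph) → (s : Fin (red J) → Bool) → ℕ → IncGraph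
addCopies J s n = record
  { red = red J
  ; blue = blue J + n
  ; E = λ e v → edge (splitAt (blue J) e) v
  ; covered = λ v → let (e , p) = covered J v in Data.Fin._↑ˡ_ e n , lem e v p
  }
  where
  edge : _ → Fin (red J) → Bool
  edge (inj₁ e) v = E J e v
  edge (inj₂ _) v = s v
  lem : (e : Fin (blue J)) (v : Fin (red J)) → E J e v ≡ true →
        edge (splitAt (blue J) (Data.Fin._↑ˡ_ e n)) v ≡ true
  lem e v p rewrite Data.Fin.Properties.splitAt-↑ˡ (blue J) e n = p

{-# OPTIONS --safe #-}
module Submission where

-- Fix the red map hR.  A blue map completes it to a homomorphism iff every
-- blue node e goes to a blue node of I adjacent to all of hR(N(e)); these
-- choices are independent, so hom(J + n·s, I) = Σ_hR w(hR) · c(hR)^n, where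
-- w(hR) is the number of completions for J itself and c(hR) the number of
-- blue nodes of I adjacent to all of hR(s).  Since s ⊆ N(e), w(hR) ≠ 0 forces
-- c(hR) ≥ 1.  Hence hom(J + n·s, I) − hom(J + n·s, I′) is an exponential sum
-- Σ d_k k^n with bases 1 ≤ k ≤ M := |B(I)| + |B(I′)|.  Such a sum vanishing at
-- M consecutive exponents vanishes identically (a Vandermonde argument), in
-- particular at n = 0, which contradicts hom(J, I) ≠ hom(J, I′).

open import Data.Fin using (Fin; zero; suc; toℕ; inject₁; _↑ˡ_; _↑ʳ_)
open import Data.List using (List; []; _∷_; _++_; map)
open import Data.List.Relation.Unary.All as All using (All; []; _∷_)
import Data.List.Relation.Unary.All.Properties as All
open import Data.Product using (∃; _×_; _,_; proj₁; proj₂; map₁)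
open import Data.Sum as Sum using (_⊎_; inj₁; inj₂)
import Data.Fin.Properties as Finₚ
open import Function using (_∘_)
open import Relation.Binary.PropositionalEquality
open import Relation.Nullary using (yes; no; contradiction; ¬_)

module ExponentialSums where

  open import Data.Nat as ℕ using (ℕ; zero; suc)
  import Data.Nat.Properties as ℕₚ
  open import Data.Integer using (ℤ; +_; -_; 0ℤ; _+_; _-_; _*_; _^_)
  import Data.Integer.Properties as ℤₚ
  open import Data.Integer.Tactic.RingSolver using (solve-∀)
  open ≡-Reasoning

  pos-^ : ∀ c n → (+ c) ^ n ≡ + (c ℕ.^ n)
  pos-^ c zero    = refl
  pos-^ c (suc n) = trans (cong (+ c *_) (pos-^ c n)) (sym (ℤₚ.pos-* c (c ℕ.^ n)))

  expSum : List (ℤ × ℕ) → ℕ → ℤ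
  expSum []             n = 0ℤ
  expSum ((d , c) ∷ ts) n = d * (+ c) ^ n + expSum ts n

  Supported : ℕ → ℤ × ℕ → Set
  Supported M t = proj₁ t ≡ 0ℤ ⊎ (1 ℕ.≤ proj₂ t × proj₂ t ℕ.≤ M)

  expSum-++ : ∀ ts us n → expSum (ts ++ us) n ≡ expSum ts n + expSum us n
  expSum-++ []             us n = sym (ℤₚ.+-identityˡ (expSum us n))
  expSum-++ ((d , c) ∷ ts) us n = begin
    d * (+ c) ^ n + expSum (ts ++ us) n          ≡⟨ cong (λ x → d * (+ c) ^ n + x) (expSum-++ ts us n) ⟩
    d * (+ c) ^ n + (expSum ts n + expSum us n)  ≡⟨ ℤₚ.+-assoc (d * (+ c) ^ n) _ _ ⟨
    d * (+ c) ^ n + expSum ts n + expSum us n    ∎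

  negateWeights : List (ℤ × ℕ) → List (ℤ × ℕ)
  negateWeights = map (map₁ (λ d → - d))

  expSum-neg : ∀ ts n → expSum (negateWeights ts) n ≡ - expSum ts n
  expSum-neg []             n = refl
  expSum-neg ((d , c) ∷ ts) n = begin
    - d * (+ c) ^ n + expSum (negateWeights ts) n  ≡⟨ cong₂ _+_ (sym (ℤₚ.neg-distribˡ-* d _)) (expSum-neg ts n) ⟩
    - (d * (+ c) ^ n) + - expSum ts n              ≡⟨ ℤₚ.neg-distrib-+ (d * (+ c) ^ n) _ ⟨
    - (d * (+ c) ^ n + expSum ts n)                ∎

  Supported-neg : ∀ {M} t → Supported M t → Supported M (map₁ (λ d → - d) t)
  Supported-neg t (inj₁ d≡0) = inj₁ (cong (λ d → - d) d≡0)
  Supported-neg t (inj₂ c∈[1,M]) = inj₂ c∈[1,M]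

  expSum-weightless : ∀ ts n → All (λ t → proj₁ t ≡ 0ℤ) ts → expSum ts n ≡ 0ℤ
  expSum-weightless []             n []            = refl
  expSum-weightless ((d , c) ∷ ts) n (refl ∷ ws) = trans (ℤₚ.+-identityˡ (expSum ts n)) (expSum-weightless ts n ws)

  shiftBy : ℤ → List (ℤ × ℕ) → List (ℤ × ℕ)
  shiftBy a = map (λ (d , c) → d * (+ c - a) , c)

  expSum-shiftBy : ∀ a ts n → expSum (shiftBy a ts) n ≡ expSum ts (suc n) - a * expSum ts n
  expSum-shiftBy a []             n = sym (cong (λ x → 0ℤ - x) (ℤₚ.*-zeroʳ a))
  expSum-shiftBy a ((d , c) ∷ ts) n rewrite expSum-shiftBy a ts n =
    shift-identity d (+ c) a ((+ c) ^ n) (expSum ts (suc n)) (expSum ts n)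
    where
    shift-identity : ∀ d c a p r₁ r₀ →
      d * (c - a) * p + (r₁ - a * r₀) ≡ (d * (c * p) + r₁) - a * (d * p + r₀)
    shift-identity = solve-∀

  Supported-shiftBy : ∀ {M} t → Supported (suc M) t → Supported M (proj₁ t * (+ proj₂ t - + suc M) , proj₂ t)
  Supported-shiftBy (d , c) (inj₁ refl) = inj₁ refl
  Supported-shiftBy {M} (d , c) (inj₂ (1≤c , c≤1+M)) with c ℕ.≟ suc M
  ... | yes refl = inj₁ (trans (cong (d *_) (ℤₚ.+-inverseʳ (+ suc M))) (ℤₚ.*-zeroʳ d))
  ... | no c≢1+M = inj₂ (1≤c , ℕ.s≤s⁻¹ (ℕₚ.≤∧≢⇒< c≤1+M c≢1+M))

  geometric-≡0 : ∀ (f : ℕ → ℤ) a m → a ≢ 0ℤ → (∀ n → f (suc n) ≡ a * f n) → f m ≡ 0ℤ → ∀ n → f n ≡ 0ℤ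
  geometric-≡0 f a m a≢0 step fm≡0 n = begin
    f n          ≡⟨ closed-form n ⟩
    a ^ n * f 0  ≡⟨ cong (a ^ n *_) f0≡0 ⟩
    a ^ n * 0ℤ   ≡⟨ ℤₚ.*-zeroʳ (a ^ n) ⟩
    0ℤ           ∎
    where
    closed-form : ∀ n → f n ≡ a ^ n * f 0
    closed-form zero    = sym (ℤₚ.*-identityˡ (f 0))
    closed-form (suc n) = begin
      f (suc n)          ≡⟨ step n ⟩
      a * f n            ≡⟨ cong (a *_) (closed-form n) ⟩
      a * (a ^ n * f 0)  ≡⟨ ℤₚ.*-assoc a (a ^ n) (f 0) ⟨
      a * a ^ n * f 0    ∎
    f0≡0 : f 0 ≡ 0ℤ
    f0≡0 with ℤₚ.i*j≡0⇒i≡0∨j≡0 (a ^ m) (trans (sym (closed-form m)) fm≡0)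
    ... | inj₁ aᵐ≡0 = contradiction (ℤₚ.i^n≡0⇒i≡0 a m aᵐ≡0) a≢0
    ... | inj₂ f0≡0 = f0≡0

  expSum-≡0 : ∀ M ts m → All (Supported M) ts → (∀ (j : Fin M) → expSum ts (m ℕ.+ toℕ j) ≡ 0ℤ) →
              ∀ n → expSum ts n ≡ 0ℤ
  expSum-≡0 zero    ts m supported vanishing n =
    expSum-weightless ts n (All.map weightless supported)
    where
    weightless : ∀ {t} → Supported 0 t → proj₁ t ≡ 0ℤ
    weightless (inj₁ d≡0)          = d≡0
    weightless (inj₂ (1≤c , c≤0)) = contradiction (ℕₚ.≤-trans 1≤c c≤0) λ ()
  -- Replacing each weight d by d (c − a) turns f(n) into f(n+1) − a f(n) and
  -- kills the terms of base a = M + 1, so the induction hypothesis applies.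
  expSum-≡0 (suc M) ts m supported vanishing =
    geometric-≡0 (expSum ts) a m (λ ()) recurrence
      (subst (λ k → expSum ts k ≡ 0ℤ) (ℕₚ.+-identityʳ m) (vanishing zero))
    where
    a : ℤ
    a = + suc M
    shifted-vanishing : ∀ (j : Fin M) → expSum (shiftBy a ts) (m ℕ.+ toℕ j) ≡ 0ℤ
    shifted-vanishing j = begin
      expSum (shiftBy a ts) (m ℕ.+ toℕ j)
        ≡⟨ expSum-shiftBy a ts (m ℕ.+ toℕ j) ⟩
      expSum ts (suc (m ℕ.+ toℕ j)) - a * expSum ts (m ℕ.+ toℕ j)
        ≡⟨ cong₂ (λ u v → u - a * v)
             (trans (cong (expSum ts) (sym (ℕₚ.+-suc m (toℕ j)))) (vanishing (suc j)))
             (trans (cong (λ k → expSum ts (m ℕ.+ k)) (sym (Finₚ.toℕ-inject₁ j))) (vanishing (inject₁ j))) ⟩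
      0ℤ - a * 0ℤ
        ≡⟨ cong (λ x → 0ℤ - x) (ℤₚ.*-zeroʳ a) ⟩
      0ℤ ∎
    recurrence : ∀ n → expSum ts (suc n) ≡ a * expSum ts n
    recurrence n = ℤₚ.i-j≡0⇒i≡j _ _ (trans (sym (expSum-shiftBy a ts n))
      (expSum-≡0 M (shiftBy a ts) m shifted-supported shifted-vanishing n))
      where
      shifted-supported : All (Supported M) (shiftBy a ts)
      shifted-supported = All.map⁺ (All.map (λ {t} → Supported-shiftBy t) supported)

open ExponentialSums
open import Defs
open import Data.Bool using (Bool; true; false; _∧_; _∨_; not)
open import Data.Bool.Properties using (_≟_)
open import Data.Nat as ℕ using (ℕ; zero; suc; _+_; _*_; _^_; _≤_; _≥_; z≤n; s≤s)
import Data.Nat.Properties as ℕₚ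
open import Data.Integer as ℤ using (ℤ; _-_; 0ℤ)
import Data.Integer.Properties as ℤₚ
open import Data.List using (length; filter; cartesianProduct; concatMap; allFin; tabulate)
import Data.List.Properties as Listₚ
open ≡-Reasoning

private variable A B : Set

∑ : List A → (A → ℕ) → ℕ
∑ []       f = 0
∑ (x ∷ xs) f = f x + ∑ xs f

infix 5 ∑
syntax ∑ xs (λ x → t) = ∑[ x ∈ xs ] t

∏ : ∀ {k} → (Fin k → ℕ) → ℕ
∏ {zero}  f = 1
∏ {suc k} f = f zero * ∏ (f ∘ suc)

∑-cong : ∀ xs {f g : A → ℕ} → (∀ x → f x ≡ g x) → ∑ xs f ≡ ∑ xs g
∑-cong []       f≗g = refl
∑-cong (x ∷ xs) f≗g = cong₂ _+_ (f≗g x) (∑-cong xs f≗g)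

∑-mono-≤ : ∀ xs {f g : A → ℕ} → (∀ x → f x ≤ g x) → ∑ xs f ≤ ∑ xs g
∑-mono-≤ []       f≤g = z≤n
∑-mono-≤ (x ∷ xs) f≤g = ℕₚ.+-mono-≤ (f≤g x) (∑-mono-≤ xs f≤g)

∑-++ : ∀ xs ys (f : A → ℕ) → ∑ (xs ++ ys) f ≡ ∑ xs f + ∑ ys f
∑-++ []       ys f = refl
∑-++ (x ∷ xs) ys f = trans (cong (f x +_) (∑-++ xs ys f)) (sym (ℕₚ.+-assoc (f x) _ _))

*-distribˡ-∑ : ∀ c xs (f : A → ℕ) → c * ∑ xs f ≡ ∑[ x ∈ xs ] c * f x
*-distribˡ-∑ c []       f = ℕₚ.*-zeroʳ c
*-distribˡ-∑ c (x ∷ xs) f = trans (ℕₚ.*-distribˡ-+ c (f x) _) (cong (c * f x +_) (*-distribˡ-∑ c xs f))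

*-distribʳ-∑ : ∀ c xs (f : A → ℕ) → ∑ xs f * c ≡ ∑[ x ∈ xs ] f x * c
*-distribʳ-∑ c []       f = refl
*-distribʳ-∑ c (x ∷ xs) f = trans (ℕₚ.*-distribʳ-+ c (f x) _) (cong (f x * c +_) (*-distribʳ-∑ c xs f))

∑-map : ∀ (g : A → B) xs (f : B → ℕ) → ∑ (map g xs) f ≡ ∑[ x ∈ xs ] f (g x)
∑-map g []       f = refl
∑-map g (x ∷ xs) f = cong (f (g x) +_) (∑-map g xs f)

∑-concatMap : ∀ (g : A → List B) xs (f : B → ℕ) → ∑ (concatMap g xs) f ≡ ∑[ x ∈ xs ] ∑ (g x) f
∑-concatMap g []       f = refl
∑-concatMap g (x ∷ xs) f = trans (∑-++ (g x) _ f) (cong (∑ (g x) f +_) (∑-concatMap g xs f))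

∑-cartesianProduct : ∀ xs ys (f : A × B → ℕ) → ∑ (cartesianProduct xs ys) f ≡ ∑[ x ∈ xs ] ∑[ y ∈ ys ] f (x , y)
∑-cartesianProduct []       ys f = refl
∑-cartesianProduct (x ∷ xs) ys f = begin
  ∑ (map (x ,_) ys ++ cartesianProduct xs ys) f
    ≡⟨ ∑-++ (map (x ,_) ys) _ f ⟩
  ∑ (map (x ,_) ys) f + ∑ (cartesianProduct xs ys) f
    ≡⟨ cong₂ _+_ (∑-map (x ,_) ys f) (∑-cartesianProduct xs ys f) ⟩
  (∑[ y ∈ ys ] f (x , y)) + (∑[ x ∈ xs ] ∑[ y ∈ ys ] f (x , y)) ∎

∏-cong : ∀ {k} {f g : Fin k → ℕ} → (∀ i → f i ≡ g i) → ∏ f ≡ ∏ g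
∏-cong {zero}  f≗g = refl
∏-cong {suc k} f≗g = cong₂ _*_ (f≗g zero) (∏-cong (f≗g ∘ suc))

∏-mono-≤ : ∀ {k} {f g : Fin k → ℕ} → (∀ i → f i ≤ g i) → ∏ f ≤ ∏ g
∏-mono-≤ {zero}  f≤g = ℕₚ.≤-refl
∏-mono-≤ {suc k} f≤g = ℕₚ.*-mono-≤ (f≤g zero) (∏-mono-≤ (f≤g ∘ suc))

∏-zero : ∀ {k} (f : Fin k → ℕ) i → f i ≡ 0 → ∏ f ≡ 0
∏-zero f zero    fi≡0 = cong (_* ∏ (f ∘ suc)) fi≡0
∏-zero f (suc i) fi≡0 = trans (cong (f zero *_) (∏-zero (f ∘ suc) i fi≡0)) (ℕₚ.*-zeroʳ (f zero))

∏-const : ∀ k c → ∏ {k} (λ _ → c) ≡ c ^ k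
∏-const zero    c = refl
∏-const (suc k) c = cong (c *_) (∏-const k c)

∏-+ : ∀ k n (f : Fin (k + n) → ℕ) → ∏ f ≡ ∏ (f ∘ (_↑ˡ n)) * ∏ (f ∘ (k ↑ʳ_))
∏-+ zero    n f = sym (ℕₚ.+-identityʳ (∏ f))
∏-+ (suc k) n f = trans (cong (f zero *_) (∏-+ k n (f ∘ suc))) (sym (ℕₚ.*-assoc (f zero) _ _))

∑-allFuns-∏ : ∀ k m (g : Fin k → Fin m → ℕ) →
  ∑[ h ∈ allFuns k m ] ∏ (λ i → g i (h i)) ≡ ∏ (λ i → ∑[ y ∈ allFin m ] g i y)
∑-allFuns-∏ zero    m g = refl
∑-allFuns-∏ (suc k) m g = begin
  ∑[ h ∈ allFuns (suc k) m ] ∏ (λ i → g i (h i))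
    ≡⟨ ∑-concatMap _ (allFin m) _ ⟩
  ∑[ y ∈ allFin m ] ∑ (map _ (allFuns k m)) (λ h → ∏ (λ i → g i (h i)))
    ≡⟨ ∑-cong (allFin m) (λ y → ∑-map _ (allFuns k m) _) ⟩
  ∑[ y ∈ allFin m ] ∑[ h ∈ allFuns k m ] g zero y * ∏ (λ i → g (suc i) (h i))
    ≡⟨ ∑-cong (allFin m) (λ y → sym (*-distribˡ-∑ (g zero y) (allFuns k m) _)) ⟩
  ∑[ y ∈ allFin m ] g zero y * (∑[ h ∈ allFuns k m ] ∏ (λ i → g (suc i) (h i)))
    ≡⟨ ∑-cong (allFin m) (λ y → cong (g zero y *_) (∑-allFuns-∏ k m (g ∘ suc))) ⟩
  ∑[ y ∈ allFin m ] g zero y * ∏ (λ i → ∑[ y ∈ allFin m ] g (suc i) y)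
    ≡⟨ *-distribʳ-∑ _ (allFin m) (g zero) ⟨
  ∏ (λ i → ∑[ y ∈ allFin m ] g i y) ∎

indicator : Bool → ℕ
indicator true  = 1
indicator false = 0

indicator-∧ : ∀ a b → indicator (a ∧ b) ≡ indicator a * indicator b
indicator-∧ true  b = sym (ℕₚ.*-identityˡ (indicator b))
indicator-∧ false b = refl

indicator≤1 : ∀ a → indicator a ≤ 1
indicator≤1 true  = s≤s z≤n
indicator≤1 false = z≤n

indicator-allB : ∀ k (p : Fin k → Bool) → indicator (allB p (allFin k)) ≡ ∏ (λ i → indicator (p i))
indicator-allB k p = indicator-allB-tabulate (λ i → i)
  where
  indicator-allB-tabulate : ∀ {k} (g : Fin k → Fin _) →
                            indicator (allB p (tabulate g)) ≡ ∏ (λ i → indicator (p (g i)))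
  indicator-allB-tabulate {zero}  g = refl
  indicator-allB-tabulate {suc k} g =
    trans (indicator-∧ (p (g zero)) _) (cong (indicator (p (g zero)) *_) (indicator-allB-tabulate (g ∘ suc)))

count : (A → Bool) → List A → ℕ
count p xs = ∑[ x ∈ xs ] indicator (p x)

length-filter≡count : ∀ (p : A → Bool) xs → length (filter (λ x → p x ≟ true) xs) ≡ count p xs
length-filter≡count p []       = refl
length-filter≡count p (x ∷ xs) with p x
... | true  = cong suc (length-filter≡count p xs)
... | false = length-filter≡count p xs

count≤length : ∀ (p : A → Bool) xs → count p xs ≤ length xs
count≤length p []       = z≤n
count≤length p (x ∷ xs) = ℕₚ.+-mono-≤ (indicator≤1 (p x)) (count≤length p xs)

-- For s = N_K(e) these y are exactly the blue nodes of I that e may be sent to.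
covers : (I : IncGraph) {r : ℕ} → (Fin r → Fin (red I)) → (Fin r → Bool) → Fin (blue I) → Bool
covers I {r} hR s y = allB (λ v → not (s v) ∨ E I y (hR v)) (allFin r)

coverCount : (I : IncGraph) {r : ℕ} → (Fin r → Fin (red I)) → (Fin r → Bool) → ℕ
coverCount I hR s = count (covers I hR s) (allFin (blue I))

hom-as-∑∏ : ∀ K I → hom K I ≡ ∑[ hR ∈ allFuns (red K) (red I) ] ∏ (λ e → coverCount I hR (E K e))
hom-as-∑∏ K I = begin
  hom K I
    ≡⟨ length-filter≡count _ (cartesianProduct reds blues) ⟩
  count (λ p → isHom K I (proj₁ p) (proj₂ p)) (cartesianProduct reds blues)
    ≡⟨ ∑-cartesianProduct reds blues _ ⟩
  ∑[ hR ∈ reds ] ∑[ hB ∈ blues ] indicator (isHom K I hR hB)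
    ≡⟨ ∑-cong reds (λ hR → ∑-cong blues (λ hB → indicator-allB (blue K) (λ e → covers I hR (E K e) (hB e)))) ⟩
  ∑[ hR ∈ reds ] ∑[ hB ∈ blues ] ∏ (λ e → indicator (covers I hR (E K e) (hB e)))
    ≡⟨ ∑-cong reds (λ hR → ∑-allFuns-∏ (blue K) (blue I) (λ e y → indicator (covers I hR (E K e) y))) ⟩
  ∑[ hR ∈ reds ] ∏ (λ e → coverCount I hR (E K e)) ∎
  where
  reds : List (Fin (red K) → Fin (red I))
  reds = allFuns (red K) (red I)
  blues : List (Fin (blue K) → Fin (blue I))
  blues = allFuns (blue K) (blue I)

not-∨-anti : ∀ {a b} c → (a ≡ true → b ≡ true) → indicator (not b ∨ c) ≤ indicator (not a ∨ c)
not-∨-anti {false} {b} c a⇒b = indicator≤1 (not b ∨ c)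
not-∨-anti {true}      c a⇒b rewrite a⇒b refl = ℕₚ.≤-refl

module _ (I : IncGraph) {r : ℕ} (hR : Fin r → Fin (red I)) where

  coverCount-anti : ∀ {s t} → (∀ v → s v ≡ true → t v ≡ true) → coverCount I hR t ≤ coverCount I hR s
  coverCount-anti {s} {t} s⊆t = ∑-mono-≤ (allFin (blue I)) λ y →
    subst₂ _≤_ (sym (indicator-allB r _)) (sym (indicator-allB r _))
      (∏-mono-≤ (λ v → not-∨-anti (E I y (hR v)) (s⊆t v)))

  coverCount-cong : ∀ {s t} → (∀ v → s v ≡ t v) → coverCount I hR s ≡ coverCount I hR t
  coverCount-cong s≗t = ℕₚ.≤-antisym (coverCount-anti (λ v tv → trans (s≗t v) tv))
                                      (coverCount-anti (λ v sv → trans (sym (s≗t v)) sv))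

  coverCount≤blue : ∀ s → coverCount I hR s ≤ blue I
  coverCount≤blue s =
    subst (coverCount I hR s ≤_) (Listₚ.length-tabulate (λ y → y)) (count≤length _ (allFin (blue I)))

weight : (J I : IncGraph) → (Fin (red J) → Fin (red I)) → ℕ
weight J I hR = ∏ (λ e → coverCount I hR (E J e))

module _ (J : IncGraph) (s : Fin (red J) → Bool) (n : ℕ) where

  E-↑ˡ : ∀ e v → E (addCopies J s n) (e ↑ˡ n) v ≡ E J e v
  E-↑ˡ e v rewrite Finₚ.splitAt-↑ˡ (blue J) e n = refl

  E-↑ʳ : ∀ i v → E (addCopies J s n) (blue J ↑ʳ i) v ≡ s v
  E-↑ʳ i v rewrite Finₚ.splitAt-↑ʳ (blue J) n i = refl

  hom-addCopies : ∀ I →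
    hom (addCopies J s n) I ≡ ∑[ hR ∈ allFuns (red J) (red I) ] weight J I hR * coverCount I hR s ^ n
  hom-addCopies I = trans (hom-as-∑∏ (addCopies J s n) I) (∑-cong (allFuns (red J) (red I)) λ hR → begin
    ∏ (λ e → coverCount I hR (E (addCopies J s n) e))
      ≡⟨ ∏-+ (blue J) n _ ⟩
    ∏ (λ e → coverCount I hR (E (addCopies J s n) (e ↑ˡ n)))
      * ∏ (λ i → coverCount I hR (E (addCopies J s n) (blue J ↑ʳ i)))
      ≡⟨ cong₂ _*_ (∏-cong (λ e → coverCount-cong I hR (E-↑ˡ e)))
                   (∏-cong (λ i → coverCount-cong I hR (E-↑ʳ i))) ⟩
    weight J I hR * ∏ {n} (λ _ → coverCount I hR s)
      ≡⟨ cong (weight J I hR *_) (∏-const n (coverCount I hR s)) ⟩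
    weight J I hR * coverCount I hR s ^ n ∎)

hom-addCopies-zero : ∀ J s I → hom (addCopies J s 0) I ≡ hom J I
hom-addCopies-zero J s I = begin
  hom (addCopies J s 0) I
    ≡⟨ hom-addCopies J s 0 I ⟩
  ∑[ hR ∈ allFuns (red J) (red I) ] weight J I hR * 1
    ≡⟨ ∑-cong (allFuns (red J) (red I)) (λ hR → ℕₚ.*-identityʳ (weight J I hR)) ⟩
  ∑[ hR ∈ allFuns (red J) (red I) ] weight J I hR
    ≡⟨ hom-as-∑∏ J I ⟨
  hom J I ∎

weight≡0⊎covered : ∀ J I {e s} → (∀ v → s v ≡ true → E J e v ≡ true) →
                   ∀ hR → weight J I hR ≡ 0 ⊎ 1 ≤ coverCount I hR s
weight≡0⊎covered J I {e} {s} s⊆Ne hR with coverCount I hR s in eq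
... | zero  = inj₁ (∏-zero _ e (ℕₚ.n≤0⇒n≡0 (subst (coverCount I hR (E J e) ≤_) eq
                                                   (coverCount-anti I hR s⊆Ne))))
... | suc _ = inj₂ (s≤s z≤n)

expSum-pos : ∀ (w c : A → ℕ) xs n →
             expSum (map (λ x → ℤ.+ w x , c x) xs) n ≡ ℤ.+ (∑[ x ∈ xs ] w x * c x ^ n)
expSum-pos w c []       n = refl
expSum-pos w c (x ∷ xs) n = begin
  ℤ.+ w x ℤ.* (ℤ.+ c x) ℤ.^ n ℤ.+ expSum (map (λ x → ℤ.+ w x , c x) xs) n
    ≡⟨ cong₂ ℤ._+_ (cong (ℤ.+ w x ℤ.*_) (pos-^ (c x) n)) (expSum-pos w c xs n) ⟩
  ℤ.+ w x ℤ.* ℤ.+ (c x ^ n) ℤ.+ ℤ.+ (∑[ x ∈ xs ] w x * c x ^ n)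
    ≡⟨ cong (ℤ._+ _) (ℤₚ.pos-* (w x) (c x ^ n)) ⟨
  ℤ.+ (w x * c x ^ n) ℤ.+ ℤ.+ (∑[ x ∈ xs ] w x * c x ^ n)
    ≡⟨ ℤₚ.pos-+ (w x * c x ^ n) _ ⟨
  ℤ.+ (∑[ x ∈ x ∷ xs ] w x * c x ^ n) ∎

homTerms : (J I : IncGraph) → (Fin (red J) → Bool) → List (ℤ × ℕ)
homTerms J I s = map (λ hR → ℤ.+ weight J I hR , coverCount I hR s) (allFuns (red J) (red I))

expSum-homTerms : ∀ J I s n → expSum (homTerms J I s) n ≡ ℤ.+ hom (addCopies J s n) I
expSum-homTerms J I s n =
  trans (expSum-pos (weight J I) (λ hR → coverCount I hR s) (allFuns (red J) (red I)) n)
        (cong (λ k → ℤ.+ k) (sym (hom-addCopies J s n I)))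

homTerms-supported : ∀ J I {e s} → (∀ v → s v ≡ true → E J e v ≡ true) →
                     ∀ {M} → blue I ≤ M → All (Supported M) (homTerms J I s)
homTerms-supported J I {s = s} s⊆Ne {M} bI≤M =
  All.map⁺ (All.universal supported (allFuns (red J) (red I)))
  where
  supported : ∀ hR → Supported M (ℤ.+ weight J I hR , coverCount I hR s)
  supported hR = Sum.map (cong (λ k → ℤ.+ k)) (λ 1≤c → 1≤c , ℕₚ.≤-trans (coverCount≤blue I hR s) bI≤M)
                         (weight≡0⊎covered J I s⊆Ne hR)

hom≡-of-addCopies-hom≡ : ∀ J I I′ {e s} → (∀ v → s v ≡ true → E J e v ≡ true) → ∀ m →
  (∀ (j : Fin (blue I + blue I′)) → hom (addCopies J s (m + toℕ j)) I ≡ hom (addCopies J s (m + toℕ j)) I′) →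
  hom J I ≡ hom J I′
hom≡-of-addCopies-hom≡ J I I′ {s = s} s⊆Ne m agree = begin
  hom J I                   ≡⟨ hom-addCopies-zero J s I ⟨
  hom (addCopies J s 0) I   ≡⟨ ℤₚ.+-injective (ℤₚ.i-j≡0⇒i≡j _ _ (trans (sym (difference 0)) vanishes-at-0)) ⟩
  hom (addCopies J s 0) I′  ≡⟨ hom-addCopies-zero J s I′ ⟩
  hom J I′                  ∎
  where
  M : ℕ
  M = blue I + blue I′
  ts : List (ℤ × ℕ)
  ts = homTerms J I s ++ negateWeights (homTerms J I′ s)
  difference : ∀ n → expSum ts n ≡ ℤ.+ hom (addCopies J s n) I - ℤ.+ hom (addCopies J s n) I′
  difference n = trans (expSum-++ (homTerms J I s) _ n)
    (cong₂ ℤ._+_ (expSum-homTerms J I s n)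
                 (trans (expSum-neg (homTerms J I′ s) n) (cong ℤ.-_ (expSum-homTerms J I′ s n))))
  supported : All (Supported M) ts
  supported = All.++⁺ (homTerms-supported J I s⊆Ne (ℕₚ.m≤m+n (blue I) (blue I′)))
                      (All.map⁺ (All.map (λ {t} → Supported-neg t)
                                         (homTerms-supported J I′ s⊆Ne (ℕₚ.m≤n+m (blue I′) (blue I)))))
  vanishing : ∀ j → expSum ts (m + toℕ j) ≡ 0ℤ
  vanishing j = trans (difference (m + toℕ j)) (trans (cong (λ k → ℤ.+ k - h′) (agree j)) (ℤₚ.+-inverseʳ h′))
    where
    h′ : ℤ
    h′ = ℤ.+ hom (addCopies J s (m + toℕ j)) I′
  vanishes-at-0 : expSum ts 0 ≡ 0ℤ
  vanishes-at-0 = expSum-≡0 M ts m supported vanishing 0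

∃-hom≢-of-¬∀-hom≡ : ∀ J I I′ s m k →
  ¬ (∀ (j : Fin k) → hom (addCopies J s (m + toℕ j)) I ≡ hom (addCopies J s (m + toℕ j)) I′) →
  ∃ λ n → n ≥ m × hom (addCopies J s n) I ≢ hom (addCopies J s n) I′
∃-hom≢-of-¬∀-hom≡ J I I′ s m k ¬agree
  with Finₚ.¬∀⟶∃¬ k _ (λ j → hom (addCopies J s (m + toℕ j)) I ℕ.≟ hom (addCopies J s (m + toℕ j)) I′)
                    ¬agree
... | j , differ = m + toℕ j , ℕₚ.m≤m+n m (toℕ j) , differ

lemma1 : (J I I′ : IncGraph) → hom J I ≢ hom J I′ →
    (e : Fin (blue J)) → (s : Fin (red J) → Bool) →
    ((v : Fin (red J)) → s v ≡ true → E J e v ≡ true) →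
    (m : ℕ) → ∃ λ (n : ℕ) → n ≥ m × hom (addCopies J s n) I ≢ hom (addCopies J s n) I′
lemma1 J I I′ hom≢ _ s s⊆Ne m =
  ∃-hom≢-of-¬∀-hom≡ J I I′ s m (blue I + blue I′) (hom≢ ∘ hom≡-of-addCopies-hom≡ J I I′ s⊆Ne m)
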